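{- Let $(i_1,j_1),(i_2,j_2),\dots,(i_k,j_k)$ be pairs of integers satisfying: $1\le k\le n$; $1\le i_1<i_2<\cdots<i_k=n$; $1=j_1<j_2<\cdots<j_k$; and $j_s\le i_{s-1}+1$ for all $2\le s\le k$. Let $\sigma$ be constructed as follows. First set $\sigma(i_s)=j_s$ for all $s\in\{1,\dots,k\}$. Then, for each $i\in[n]\setminus\{i_1,\dots,i_k\}$ taken in decreasing order, let $s$ be such that $i_{s-1}<i<i_s$ (with $i_0=0$); with $\sigma$ denoting the partial injective map defined so far, set $\sigma(i)=\sigma^{ -t}(j_s)$, where $t$ is the smallest positive integer such that $\sigma^{ -t}(j_s)$ has not yet been assigned as the image of any integer. Then $\sigma$ is a permutation of $[n]$ whose anti-exceedances are exactly $i_1,i_2,\dots,i_k$, with $\sigma(i_s)=j_s$, and its nom code is $$\phi^{ -1}(\sigma)=1^{i_1}\,j_2^{\,i_2-i_1}\cdots j_k^{\,n-i_{k-1}}$$ (the word consisting of $i_1$ letters $1$, followed by $i_2-i_1$ letters $j_2$, ..., followed by $n-i_{k-1}$ letters $j_k$).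
   Context: $[n]=\{1,\dots,n\}$, $\mathfrak{S}_n$ the symmetric group on $[n]$; products of permutations are composed with the leftmost factor acting first: $(\alpha\beta)(x)=\beta(\alpha(x))$. During the construction, $\sigma^{ -1}(y)$ denotes the unique $x$ whose image $\sigma(x)=y$ has already been defined, and $\sigma^{ -t}=\sigma^{ -1}\circ\sigma^{ -(t-1)}$ (this construction is well defined). A function $f:[n]\to[n]$ is subexceedant if $1\le f(i)\le i$ for all $i$, written as the word $f_1\cdots f_n$; $F_n$ is the set of such functions. $\phi:F_n\to\mathfrak{S}_n$, $\phi(f)=(1,f_1)(2,f_2)\cdots(n,f_n)$ (with $(i,i)$ the identity), is a bijection, and $\phi^{ -1}(\sigma)$ is called the nom code of $\sigma$. An anti-exceedance of $\sigma$ is an $i$ with $\sigma(i)\le i$. -}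

module Defs where

open import Data.Nat using (ℕ; zero; suc; _+_; _∸_; _≤_; _<_; _≡ᵇ_; _<ᵇ_)
open import Data.Bool using (Bool; true; false; if_then_else_)
open import Data.Maybe using (Maybe; just; nothing; _>>=_; fromMaybe)
open import Data.Product using (_×_; _,_; proj₁; proj₂; ∃)
open import Data.List using (List; []; _∷_; _++_; map; replicate; upTo; length)
open import Data.Bool.ListAction using (any)
open import Relation.Binary.PropositionalEquality using (_≡_)
open import Relation.Nullary using (¬_)

-- Partial injective maps on ℕ, as finite graphs: list of pairs (x , σ x).

PMap : Set
PMap = List (ℕ × ℕ)

applyP : PMap → ℕ → Maybe ℕ
applyP [] x = nothing
applyP ((a , b) ∷ m) x = if a ≡ᵇ x then just b else applyP m x

preimage : PMap → ℕ → Maybe ℕ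
preimage [] y = nothing
preimage ((a , b) ∷ m) y = if b ≡ᵇ y then just a else preimage m y

-- chase fuel m y: with x₀ = y and x_t = σ⁻¹(x_{t-1}), returns x_t for the
-- smallest t ≥ 1 such that x_t is not (yet) the image of any integer.
chase : ℕ → PMap → ℕ → Maybe ℕ
chase zero m y = nothing
chase (suc f) m y with preimage m y
... | nothing = nothing
... | just x with preimage m x
...   | nothing = just x
...   | just _  = chase f m x

pairs : ℕ → (ℕ → ℕ) → (ℕ → ℕ) → List (ℕ × ℕ)
pairs k I J = map (λ r → (I (suc r) , J (suc r))) (upTo k)

isMarked : List (ℕ × ℕ) → ℕ → Bool
isMarked ps x = any (λ p → proj₁ p ≡ᵇ x) ps

-- j_s for the first s with i < i_s (i.e. i_{s-1} < i < i_s, as the i_s increase)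
block : List (ℕ × ℕ) → ℕ → Maybe ℕ
block [] i = nothing
block ((a , b) ∷ ps) i = if i <ᵇ a then just b else block ps i

fill : ℕ → List (ℕ × ℕ) → ℕ → PMap → Maybe PMap
fill n ps zero m = just m
fill n ps (suc i) m =
  if isMarked ps (suc i) then fill n ps i m
  else (block ps (suc i) >>= λ j →
        chase (suc n) m j >>= λ y →
        fill n ps i ((suc i , y) ∷ m))

construct : (n k : ℕ) → (ℕ → ℕ) → (ℕ → ℕ) → Maybe PMap
construct n k I J = fill n (pairs k I J) n (pairs k I J)

-- total function associated with a partial map (value 0 ∉ [n] where undefined)
toFun : PMap → ℕ → ℕ
toFun m x = fromMaybe 0 (applyP m x)

InRange : ℕ → ℕ → Set
InRange n x = 1 ≤ x × x ≤ n

IsPermOf : ℕ → (ℕ → ℕ) → Set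
IsPermOf n σ =
  (∀ x → InRange n x → InRange n (σ x)) ×
  (∀ x y → InRange n x → InRange n y → σ x ≡ σ y → x ≡ y) ×
  (∀ y → InRange n y → ∃ λ x → InRange n x × σ x ≡ y)

subexFrom : ℕ → List ℕ → Set
subexFrom i [] = Data.Unit.⊤ where import Data.Unit
subexFrom i (f ∷ fs) = (1 ≤ f × f ≤ i) × subexFrom (suc i) fs

IsSubexceedant : ℕ → List ℕ → Set
IsSubexceedant n f = length f ≡ n × subexFrom 1 f

transp : ℕ → ℕ → ℕ → ℕ
transp a b x = if x ≡ᵇ a then b else (if x ≡ᵇ b then a else x)

-- φ(f) = (1,f_1)(2,f_2)⋯(n,f_n), leftmost factor acting first:
-- φ(f)(x) = (n,f_n)( ⋯ (1,f_1)(x) ⋯ )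
phiFrom : ℕ → List ℕ → ℕ → ℕ
phiFrom i [] x = x
phiFrom i (f ∷ fs) x = phiFrom (suc i) fs (transp i f x)

phi : List ℕ → ℕ → ℕ
phi f = phiFrom 1 f

-- φ⁻¹(σ) = f, i.e. f ∈ F_n and φ(f) = σ (φ : F_n → 𝔖_n is a bijection)
NomCodeIs : ℕ → (ℕ → ℕ) → List ℕ → Set
NomCodeIs n σ f = IsSubexceedant n f × (∀ x → InRange n x → phi f x ≡ σ x)

nomWord : ℕ → (ℕ → ℕ) → (ℕ → ℕ) → List ℕ
nomWord zero I J = []
nomWord (suc k) I J =
  nomWord k I J ++ replicate (I (suc k) ∸ prev k) (J (suc k))
  where
  prev : ℕ → ℕ
  prev zero = 0
  prev (suc r) = I (suc r)

IsAntiExc : (ℕ → ℕ) → ℕ → Set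
IsAntiExc σ i = σ i ≤ i

-- Let w = 1^{i₁} j₂^{i₂-i₁} ⋯ j_k^{n-i_{k-1}} and σ = φ(w) = (1,w₁)(2,w₂)⋯(n,w_n).
-- The factors (p, j_s) of the s-th block i_{s-1} < p ≤ i_s, where j_s ≤ i_{s-1}+1, compose to
-- the cycle j_s → i_{s-1}+1 → ⋯ → i_s → j_s, and later factors do not disturb σ(i_s) = j_s;
-- so the i_s are exactly the anti-exceedances. For an unmarked i of block s, the σ-orbit of i
-- climbs through (i, n] until it reaches j_s: this holds after the s-th block, and each later
-- factor (q+1, w_{q+1}) multiplies a map fixing q+1, so it only splices q+1 into the orbit.
-- When the construction treats i, the points with an assigned image are the marked ones and
-- those above i, so chasing preimages from j_s runs back along this orbit and stops at σ(i).
-- Hence the construction computes σ.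

module Submission where

open import Defs
open import Data.Nat using (ℕ; zero; suc; _+_; _∸_; _≤_; _<_; _≡ᵇ_; _<ᵇ_; z≤n; s≤s)
open import Data.Nat.Properties
open import Data.Nat.GeneralisedArithmetic using (fold; fold-+)
open import Data.Bool using (true; false; T)
open import Data.Maybe using (just; nothing; fromMaybe)
open import Data.List using (List; []; _∷_; _++_; [_]; map; upTo; replicate; length)
open import Data.Product using (_×_; _,_; proj₁; proj₂; ∃)
open import Data.Sum using (_⊎_; inj₁; inj₂)
open import Data.List.Properties using (upTo-∷ʳ; map-++; length-++; length-replicate)
open import Data.List.Membership.Propositional using (_∈_; _∉_; find; lose)
open import Data.List.Membership.Propositional.Properties using (∈-map⁺; ∈-map⁻; ∈-upTo⁺; ∈-upTo⁻)
open import Data.List.Relation.Unary.Any.Properties using (any⁺; any⁻)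
open import Data.List.Relation.Unary.Any using (here; there)
open import Function using (_∘_)
open import Function.Bundles using (_⇔_; mk⇔)
open import Function.Definitions using (Injective)
open import Relation.Nullary using (¬_; yes; no; contradiction)
open import Relation.Nullary.Reflects using (Reflects; ofʸ; ofⁿ; fromEquivalence)
open import Relation.Binary.PropositionalEquality hiding ([_])
open import Relation.Binary.Definitions using (tri<; tri≈; tri>)

≡ᵇ-reflects : ∀ m n → Reflects (m ≡ n) (m ≡ᵇ n)
≡ᵇ-reflects m n = fromEquivalence (≡ᵇ⇒≡ m n) (≡⇒≡ᵇ m n)

transp-left : ∀ a b → transp a b a ≡ b
transp-left a b with a ≡ᵇ a | ≡ᵇ-reflects a a
... | true  | _      = refl
... | false | ofⁿ ¬p = contradiction refl ¬p

transp-right : ∀ a b → transp a b b ≡ a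
transp-right a b with b ≡ᵇ a | ≡ᵇ-reflects b a | b ≡ᵇ b | ≡ᵇ-reflects b b
... | true  | ofʸ b≡a | _     | _      = b≡a
... | false | _       | true  | _      = refl
... | false | _       | false | ofⁿ ¬p = contradiction refl ¬p

transp-other : ∀ {a b x} → x ≢ a → x ≢ b → transp a b x ≡ x
transp-other {a} {b} {x} x≢a x≢b with x ≡ᵇ a | ≡ᵇ-reflects x a | x ≡ᵇ b | ≡ᵇ-reflects x b
... | true  | ofʸ x≡a | _     | _       = contradiction x≡a x≢a
... | false | _       | true  | ofʸ x≡b = contradiction x≡b x≢b
... | false | _       | false | _       = refl

transp-preserves : (P : ℕ → Set) → ∀ {a b x} → P a → P b → P x → P (transp a b x)
transp-preserves P {a} {b} {x} Pa Pb Px with x ≡ᵇ a | x ≡ᵇ b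
... | true  | _     = Pb
... | false | true  = Pa
... | false | false = Px

transp-involutive : ∀ a b x → transp a b (transp a b x) ≡ x
transp-involutive a b x with x ≟ a | x ≟ b
... | yes refl | _        = trans (cong (transp a b) (transp-left a b)) (transp-right a b)
... | no _     | yes refl = trans (cong (transp a b) (transp-right a b)) (transp-left a b)
... | no x≢a   | no x≢b   = trans (cong (transp a b) (transp-other x≢a x≢b)) (transp-other x≢a x≢b)

fold-injective : ∀ {f : ℕ → ℕ} → Injective _≡_ _≡_ f → ∀ i → Injective _≡_ _≡_ (λ z → fold z f i)
fold-injective f-inj zero    eq = eq
fold-injective f-inj (suc i) eq = fold-injective f-inj i (f-inj eq)

preimage-unique : ∀ {m : PMap} {y u} → (∀ {a} → (a , y) ∈ m → a ≡ u) → (u , y) ∈ m →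
                  preimage m y ≡ just u
preimage-unique {(a , b) ∷ m} {y} uniq mem with b ≡ᵇ y | ≡ᵇ-reflects b y
... | true  | ofʸ refl = cong just (uniq (here refl))
... | false | ofⁿ b≢y with mem
...   | here refl = contradiction refl b≢y
...   | there mem′ = preimage-unique (uniq ∘ there) mem′

preimage-absent : ∀ {m : PMap} {y} → (∀ {a} → (a , y) ∉ m) → preimage m y ≡ nothing
preimage-absent {[]}          absent = refl
preimage-absent {(a , b) ∷ m} {y} absent with b ≡ᵇ y | ≡ᵇ-reflects b y
... | true  | ofʸ refl = contradiction (here refl) absent
... | false | _        = preimage-absent (absent ∘ there)

applyP-unique : ∀ {m : PMap} {x v} → (∀ {b} → (x , b) ∈ m → b ≡ v) → (x , v) ∈ m →
                applyP m x ≡ just v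
applyP-unique {(a , b) ∷ m} {x} uniq mem with a ≡ᵇ x | ≡ᵇ-reflects a x
... | true  | ofʸ refl = cong just (uniq (here refl))
... | false | ofⁿ a≢x with mem
...   | here refl = contradiction refl a≢x
...   | there mem′ = applyP-unique (uniq ∘ there) mem′

record IsGraphOn (σ : ℕ → ℕ) (D : ℕ → Set) (m : PMap) : Set where
  field
    sound    : ∀ {a b} → (a , b) ∈ m → D a × b ≡ σ a
    complete : ∀ {a} → D a → (a , σ a) ∈ m

graph-cong : ∀ {σ D D′ m} → (∀ {a} → D a → D′ a) → (∀ {a} → D′ a → D a) →
             IsGraphOn σ D m → IsGraphOn σ D′ m
graph-cong to from G = record
  { sound    = λ mem → let (Da , eq) = sound mem in to Da , eq
  ; complete = complete ∘ from
  }
  where open IsGraphOn G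

graph-extend : ∀ {σ D D′ m u} → (∀ {a} → D a → D′ a) → (∀ {a} → D′ a → D a ⊎ a ≡ u) → D′ u →
               IsGraphOn σ D m → IsGraphOn σ D′ ((u , σ u) ∷ m)
graph-extend {σ} {D} {D′} {m} {u} to from D′u G = record { sound = sound′ ; complete = complete′ }
  where
  open IsGraphOn G
  sound′ : ∀ {a b} → (a , b) ∈ (u , σ u) ∷ m → D′ a × b ≡ σ a
  sound′ (here refl)  = D′u , refl
  sound′ (there mem) = let (Da , eq) = sound mem in to Da , eq
  complete′ : ∀ {a} → D′ a → (a , σ a) ∈ (u , σ u) ∷ m
  complete′ D′a with from D′a
  ... | inj₁ Da   = there (complete Da)
  ... | inj₂ refl = here refl

module GraphOf {σ : ℕ → ℕ} (σ-inj : Injective _≡_ _≡_ σ) {D : ℕ → Set} {m : PMap}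
               (G : IsGraphOn σ D m) where
  open IsGraphOn G

  preimage-inside : ∀ {u} → D u → preimage m (σ u) ≡ just u
  preimage-inside Du = preimage-unique (λ mem → σ-inj (sym (proj₂ (sound mem)))) (complete Du)

  preimage-outside : ∀ {u} → ¬ D u → preimage m (σ u) ≡ nothing
  preimage-outside {u} ¬Du = preimage-absent absent
    where
    absent : ∀ {a} → (a , σ u) ∉ m
    absent mem with sound mem
    ... | Da , eq = ¬Du (subst D (σ-inj (sym eq)) Da)

  applyP-inside : ∀ {u} → D u → applyP m u ≡ just (σ u)
  applyP-inside Du = applyP-unique (λ mem → proj₂ (sound mem)) (complete Du)

  chase-orbit : ∀ {x} → ¬ D x → ∀ {ℓ fuel} → 1 ≤ ℓ → ℓ ≤ fuel →
                (∀ {i} → i < ℓ → D (fold x σ (suc i))) →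
                chase fuel m (fold x σ (suc ℓ)) ≡ just (σ x)
  chase-orbit ¬Dx {suc zero} {suc fuel} _ _ inD
    rewrite preimage-inside (inD {0} (s≤s z≤n)) | preimage-outside ¬Dx = refl
  chase-orbit ¬Dx {suc (suc ℓ)} {suc fuel} _ (s≤s ℓ≤fuel) inD
    rewrite preimage-inside (inD {suc ℓ} ≤-refl) | preimage-inside (inD {ℓ} (m≤n⇒m≤1+n ≤-refl))
    = chase-orbit ¬Dx (s≤s z≤n) ℓ≤fuel (inD ∘ m≤n⇒m≤1+n)

record Excursion (f : ℕ → ℕ) (x q ℓ y : ℕ) : Set where
  field
    nonempty : 1 ≤ ℓ
    -- implied by distinctness of the orbit points; it bounds the fuel that chase needs
    fits     : ℓ + x ≤ q
    inside   : ∀ {i} → i < ℓ → x < fold x f (suc i) × fold x f (suc i) ≤ q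
    lands    : fold x f (suc ℓ) ≡ y

-- Composing f with the transposition (q+1, w), where q+1 is a fixed point of f, splices
-- q+1 into the orbit of x just before w (if w occurs in the excursion at all).
module Splice {f : ℕ → ℕ} (f-inj : Injective _≡_ _≡_ f) {q : ℕ} (w : ℕ) (f-fix : f (suc q) ≡ suc q)
              {x ℓ y : ℕ} (y≤q : y ≤ q) (E : Excursion f x q ℓ y) where
  open Excursion E

  g : ℕ → ℕ
  g z = transp (suc q) w (f z)

  orbit≤q : ∀ {t} → t ≤ ℓ → fold x f (suc t) ≤ q
  orbit≤q t≤ℓ with m≤n⇒m<n∨m≡n t≤ℓ
  ... | inj₁ t<ℓ  = proj₂ (inside t<ℓ)
  ... | inj₂ refl = subst (_≤ q) (sym lands) y≤q

  orbit-distinct : ∀ {t u} → t < u → u ≤ ℓ → fold x f (suc t) ≢ fold x f (suc u)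
  orbit-distinct {t} t<u u≤ℓ eq with m≤n⇒∃[o]m+o≡n t<u
  ... | k , refl = <-irrefl (sym returns) (proj₁ (inside k<ℓ))
    where
    open ≡-Reasoning
    k<ℓ : k < ℓ
    k<ℓ = <-≤-trans (s≤s (m≤n+m k t)) u≤ℓ
    returns : fold x f (suc k) ≡ x
    returns = fold-injective f-inj (suc t) (begin
      fold (fold x f (suc k)) f (suc t) ≡⟨ fold-+ x f (suc t) ⟨
      fold x f (suc t + suc k)          ≡⟨ cong (λ r → fold x f (suc r)) (+-suc t k) ⟩
      fold x f (suc (suc (t + k)))      ≡⟨ eq ⟨
      fold x f (suc t)                  ∎)

  g-agrees : ∀ {t} → t ≤ ℓ → fold x f (suc t) ≢ w → g (fold x f t) ≡ fold x f (suc t)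
  g-agrees t≤ℓ = transp-other (λ eq → 1+n≰n (subst (_≤ q) eq (orbit≤q t≤ℓ)))

  widen : ∀ {v} → x < v × v ≤ q → x < v × v ≤ suc q
  widen (x<v , v≤q) = x<v , m≤n⇒m≤1+n v≤q

  module Avoiding (miss : ∀ {t} → t ≤ ℓ → fold x f (suc t) ≢ w) where
    same-orbit : ∀ {t} → t ≤ suc ℓ → fold x g t ≡ fold x f t
    same-orbit {zero}  _         = refl
    same-orbit {suc t} (s≤s t≤ℓ) =
      trans (cong g (same-orbit (m≤n⇒m≤1+n t≤ℓ))) (g-agrees t≤ℓ (miss t≤ℓ))

    unchanged : Excursion g x (suc q) ℓ y
    unchanged = record
      { nonempty = nonempty
      ; fits     = m≤n⇒m≤1+n fits
      ; inside   = λ i<ℓ → subst (λ v → x < v × v ≤ suc q) (sym (same-orbit (s≤s (<⇒≤ i<ℓ))))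
                                  (widen (inside i<ℓ))
      ; lands    = trans (same-orbit ≤-refl) lands
      }

  module Hitting {t₀ : ℕ} (t₀≤ℓ : t₀ ≤ ℓ) (hit : fold x f (suc t₀) ≡ w) where
    open ≡-Reasoning

    before : ∀ {t} → t ≤ t₀ → fold x g t ≡ fold x f t
    before {zero}  _    = refl
    before {suc t} t<t₀ = trans (cong g (before (<⇒≤ t<t₀)))
      (g-agrees (≤-trans (<⇒≤ t<t₀) t₀≤ℓ) (λ eq → orbit-distinct t<t₀ t₀≤ℓ (trans eq (sym hit))))

    at : fold x g (suc t₀) ≡ suc q
    at = begin
      g (fold x g t₀)                      ≡⟨ cong g (before ≤-refl) ⟩
      transp (suc q) w (fold x f (suc t₀)) ≡⟨ cong (transp (suc q) w) hit ⟩
      transp (suc q) w w                   ≡⟨ transp-right (suc q) w ⟩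
      suc q                                ∎

    after : ∀ {t} → t₀ < t → t ≤ suc ℓ → fold x g (suc t) ≡ fold x f t
    after {suc t} (s≤s t₀≤t) t<1+ℓ with m≤n⇒m<n∨m≡n t₀≤t
    ... | inj₂ refl = begin
      g (fold x g (suc t₀))        ≡⟨ cong g at ⟩
      transp (suc q) w (f (suc q)) ≡⟨ cong (transp (suc q) w) f-fix ⟩
      transp (suc q) w (suc q)     ≡⟨ transp-left (suc q) w ⟩
      w                            ≡⟨ hit ⟨
      fold x f (suc t₀)            ∎
    ... | inj₁ t₀<t = trans (cong g (after t₀<t (m≤n⇒m≤1+n t≤ℓ)))
      (g-agrees t≤ℓ (λ eq → orbit-distinct t₀<t t≤ℓ (trans hit (sym eq))))
      where t≤ℓ = ≤-pred t<1+ℓ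

    x<1+q : x < suc q
    x<1+q = let (x<v , v≤q) = inside nonempty in m≤n⇒m≤1+n (<-≤-trans x<v v≤q)

    inside′ : ∀ {i} → i < suc ℓ → x < fold x g (suc i) × fold x g (suc i) ≤ suc q
    inside′ {i} i<1+ℓ with <-cmp i t₀
    ... | tri< i<t₀ _ _ = subst (λ v → x < v × v ≤ suc q) (sym (before i<t₀))
                                (widen (inside (<-≤-trans i<t₀ t₀≤ℓ)))
    ... | tri≈ _ refl _ = subst (λ v → x < v × v ≤ suc q) (sym at) (x<1+q , ≤-refl)
    ... | tri> _ _ t₀<i = late t₀<i i<1+ℓ
      where
      late : ∀ {i} → t₀ < i → i < suc ℓ → x < fold x g (suc i) × fold x g (suc i) ≤ suc q
      late {suc i} t₀<1+i (s≤s i<ℓ) =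
        subst (λ v → x < v × v ≤ suc q) (sym (after t₀<1+i (<⇒≤ (s≤s i<ℓ)))) (widen (inside i<ℓ))

    spliced : Excursion g x (suc q) (suc ℓ) y
    spliced = record
      { nonempty = s≤s z≤n
      ; fits     = s≤s fits
      ; inside   = inside′
      ; lands    = trans (after (s≤s t₀≤ℓ) ≤-refl) lands
      }

  excursion : ∃ λ ℓ′ → Excursion g x (suc q) ℓ′ y
  excursion with anyUpTo? (λ t → fold x f (suc t) ≟ w) (suc ℓ)
  ... | yes (t₀ , t₀<1+ℓ , hit) = suc ℓ , Hitting.spliced (≤-pred t₀<1+ℓ) hit
  ... | no none                 = ℓ , Avoiding.unchanged (λ t≤ℓ eq → none (_ , s≤s t≤ℓ , eq))

block-++-just : ∀ (L L′ : List (ℕ × ℕ)) {y b} → block L y ≡ just b → block (L ++ L′) y ≡ just b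
block-++-just ((a , c) ∷ L) L′ {y} eq with y <ᵇ a
... | true  = eq
... | false = block-++-just L L′ eq

block-++-nothing : ∀ (L L′ : List (ℕ × ℕ)) {y} → block L y ≡ nothing →
                   block (L ++ L′) y ≡ block L′ y
block-++-nothing []            L′ _ = refl
block-++-nothing ((a , c) ∷ L) L′ {y} eq with y <ᵇ a
... | false = block-++-nothing L L′ eq

block-single-≥ : ∀ {a b y} → a ≤ y → block [ (a , b) ] y ≡ nothing
block-single-≥ {a} {b} {y} a≤y with y <ᵇ a | <ᵇ-reflects-< y a
... | true  | ofʸ y<a = contradiction y<a (≤⇒≯ a≤y)
... | false | _       = refl

block-single-< : ∀ {a b y} → y < a → block [ (a , b) ] y ≡ just b
block-single-< {a} {b} {y} y<a with y <ᵇ a | <ᵇ-reflects-< y a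
... | true  | _        = refl
... | false | ofⁿ y≮a = contradiction y<a y≮a

module _ {k : ℕ} {F : ℕ → ℕ} (F-step : ∀ s → 1 ≤ s → s < k → F s < F (suc s)) where

  increasing-< : ∀ {a b} → 1 ≤ a → a < b → b ≤ k → F a < F b
  increasing-< {a} {suc b} 1≤a (s≤s a≤b) b<k with m≤n⇒m<n∨m≡n a≤b
  ... | inj₂ refl = F-step a 1≤a b<k
  ... | inj₁ a<b  = <-trans (increasing-< 1≤a a<b (<⇒≤ b<k)) (F-step b (≤-trans 1≤a a≤b) b<k)

  increasing-≤ : ∀ {a b} → 1 ≤ a → a ≤ b → b ≤ k → F a ≤ F b
  increasing-≤ 1≤a a≤b b≤k with m≤n⇒m<n∨m≡n a≤b
  ... | inj₂ refl = ≤-refl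
  ... | inj₁ a<b  = <⇒≤ (increasing-< 1≤a a<b b≤k)

phiFrom-++ : ∀ i u v z → phiFrom i (u ++ v) z ≡ phiFrom (i + length u) v (phiFrom i u z)
phiFrom-++ i []      v z rewrite +-identityʳ i = refl
phiFrom-++ i (f ∷ u) v z rewrite +-suc i (length u) = phiFrom-++ (suc i) u v (transp i f z)

subexFrom-++ : ∀ i u v → subexFrom i u → subexFrom (i + length u) v → subexFrom i (u ++ v)
subexFrom-++ i []      v _            sv rewrite +-identityʳ i = sv
subexFrom-++ i (f ∷ u) v (f-ok , su) sv rewrite +-suc i (length u) = f-ok , subexFrom-++ (suc i) u v su sv

subexFrom-replicate : ∀ {i c} r → 1 ≤ c → c ≤ i → subexFrom i (replicate r c)
subexFrom-replicate zero    _   _   = _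
subexFrom-replicate (suc r) 1≤c c≤i = (1≤c , c≤i) , subexFrom-replicate r 1≤c (m≤n⇒m≤1+n c≤i)

IsPermOf-agree : ∀ {n f g} → (∀ x → InRange n x → f x ≡ g x) → IsPermOf n f → IsPermOf n g
IsPermOf-agree {n} f≗g (range , inj , surj) =
  (λ x x∈ → subst (InRange n) (f≗g x x∈) (range x x∈)) ,
  (λ x y x∈ y∈ eq → inj x y x∈ y∈ (trans (f≗g x x∈) (trans eq (sym (f≗g y y∈))))) ,
  (λ y y∈ → let (x , x∈ , fx≡y) = surj y y∈ in x , x∈ , trans (sym (f≗g x x∈)) fx≡y)

NomCodeIs-agree : ∀ {n f g w} → (∀ x → InRange n x → f x ≡ g x) → NomCodeIs n f w → NomCodeIs n g w
NomCodeIs-agree f≗g (subex , φw≗f) = subex , λ x x∈ → trans (φw≗f x x∈) (f≗g x x∈)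

module Construction (n k : ℕ) (I J : ℕ → ℕ)
    (1≤k : 1 ≤ k) (1≤I₁ : 1 ≤ I 1)
    (I-step : ∀ s → 1 ≤ s → s < k → I s < I (suc s)) (Iₖ≡n : I k ≡ n)
    (J₁≡1 : J 1 ≡ 1) (J-step : ∀ s → 1 ≤ s → s < k → J s < J (suc s))
    (J-bound : ∀ s → 2 ≤ s → s ≤ k → J s ≤ I (s ∸ 1) + 1) where

  prevI : ℕ → ℕ
  prevI zero          = 0
  prevI (suc zero)    = 0
  prevI (suc (suc s)) = I (suc s)

  InBlock : ℕ → ℕ → Set
  InBlock p s = InRange k s × prevI s < p × p ≤ I s

  Marked : ℕ → Set
  Marked y = ∃ λ s → InRange k s × I s ≡ y

  I-range : ∀ {s} → InRange k s → InRange n (I s)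
  I-range {s} (1≤s , s≤k) =
    ≤-trans 1≤I₁ (increasing-≤ I-step ≤-refl 1≤s s≤k) ,
    subst (I s ≤_) Iₖ≡n (increasing-≤ I-step 1≤s s≤k ≤-refl)

  prevI<I : ∀ {s} → InRange k s → prevI s < I s
  prevI<I {suc zero}    _        = 1≤I₁
  prevI<I {suc (suc s)} (_ , s<k) = I-step (suc s) (s≤s z≤n) s<k

  J≤1+prevI : ∀ {s} → InRange k s → J s ≤ suc (prevI s)
  J≤1+prevI {suc zero}    _           = ≤-reflexive J₁≡1
  J≤1+prevI {suc (suc s)} (_ , s<k) =
    subst (J (suc (suc s)) ≤_) (+-comm (I (suc s)) 1) (J-bound (suc (suc s)) (s≤s (s≤s z≤n)) s<k)

  J≥1 : ∀ {s} → InRange k s → 1 ≤ J s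
  J≥1 {s} (1≤s , s≤k) = subst (_≤ J s) J₁≡1 (increasing-≤ J-step ≤-refl 1≤s s≤k)

  J≤I : ∀ {s} → InRange k s → J s ≤ I s
  J≤I s∈ = ≤-trans (J≤1+prevI s∈) (prevI<I s∈)

  block-below : ∀ {p} r → 1 ≤ p → suc r ≤ k → p ≤ I (suc r) → ∃ (InBlock p)
  block-below zero        1≤p 1≤k p≤I = 1 , (≤-refl , 1≤k) , 1≤p , p≤I
  block-below {p} (suc r) 1≤p r<k p≤I with p ≤? I (suc r)
  ... | yes p≤I′ = block-below r 1≤p (<⇒≤ r<k) p≤I′
  ... | no  p≰I′ = suc (suc r) , (s≤s z≤n , r<k) , ≰⇒> p≰I′ , p≤I

  block-of : ∀ {p} → InRange n p → ∃ (InBlock p)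
  block-of {p} (1≤p , p≤n) with m≤n⇒∃[o]m+o≡n 1≤k
  ... | r , 1+r≡k = block-below r 1≤p (≤-reflexive 1+r≡k)
                      (subst (λ t → p ≤ I t) (sym 1+r≡k) (subst (p ≤_) (sym Iₖ≡n) p≤n))

  ps : List (ℕ × ℕ)
  ps = pairs k I J

  pairs-snoc : ∀ t → pairs (suc t) I J ≡ pairs t I J ++ [ (I (suc t) , J (suc t)) ]
  pairs-snoc t = trans (cong (map g) (sym (upTo-∷ʳ t))) (map-++ g (upTo t) [ t ])
    where
    g : ℕ → ℕ × ℕ
    g r = I (suc r) , J (suc r)

  block-past : ∀ {t y} → t ≤ k → prevI (suc t) ≤ y → block (pairs t I J) y ≡ nothing
  block-past {zero}      _   _       = refl
  block-past {suc t} {y} t<k prev≤y = begin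
    block (pairs (suc t) I J) y                             ≡⟨ cong (λ L → block L y) (pairs-snoc t) ⟩
    block (pairs t I J ++ [ (I (suc t) , J (suc t)) ]) y   ≡⟨ block-++-nothing (pairs t I J) _ earlier ⟩
    block [ (I (suc t) , J (suc t)) ] y                     ≡⟨ block-single-≥ prev≤y ⟩
    nothing                                                 ∎
    where
    open ≡-Reasoning
    earlier : block (pairs t I J) y ≡ nothing
    earlier = block-past (<⇒≤ t<k) (≤-trans (<⇒≤ (prevI<I (s≤s z≤n , t<k))) prev≤y)

  block-pairs : ∀ {t s y} → t ≤ k → 1 ≤ s → s ≤ t → prevI s ≤ y → y < I s →
                block (pairs t I J) y ≡ just (J s)
  block-pairs {zero} _ 1≤s s≤0 = contradiction (≤-trans 1≤s s≤0) λ ()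
  block-pairs {suc t} {s} {y} t<k 1≤s s≤1+t prev≤y y<I =
    trans (cong (λ L → block L y) (pairs-snoc t)) (last-or-earlier (m≤n⇒m<n∨m≡n s≤1+t))
    where
    last-or-earlier : s < suc t ⊎ s ≡ suc t →
                      block (pairs t I J ++ [ (I (suc t) , J (suc t)) ]) y ≡ just (J s)
    last-or-earlier (inj₁ s<1+t) =
      block-++-just (pairs t I J) _ (block-pairs (<⇒≤ t<k) 1≤s (≤-pred s<1+t) prev≤y y<I)
    last-or-earlier (inj₂ refl) =
      trans (block-++-nothing (pairs t I J) _ (block-past (<⇒≤ t<k) prev≤y)) (block-single-< y<I)

  ∈-pairs⁻ : ∀ {a b} → (a , b) ∈ ps → ∃ λ s → InRange k s × a ≡ I s × b ≡ J s
  ∈-pairs⁻ mem with ∈-map⁻ (λ r → (I (suc r) , J (suc r))) mem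
  ... | r , r∈ , refl = suc r , (s≤s z≤n , ∈-upTo⁻ r∈) , refl , refl

  ∈-pairs⁺ : ∀ {s} → InRange k s → (I s , J s) ∈ ps
  ∈-pairs⁺ {suc r} (_ , r<k) = ∈-map⁺ (λ r → (I (suc r) , J (suc r))) (∈-upTo⁺ r<k)

  marked-reflects : ∀ y → Reflects (Marked y) (isMarked ps y)
  marked-reflects y = fromEquivalence found listed
    where
    found : T (isMarked ps y) → Marked y
    found t with find (any⁻ _ ps t)
    ... | (a , b) , mem , a≡ᵇy with ∈-pairs⁻ mem
    ...   | s , s∈ , refl , _ = s , s∈ , ≡ᵇ⇒≡ (I s) y a≡ᵇy
    listed : Marked y → T (isMarked ps y)
    listed (s , s∈ , refl) = any⁺ _ (lose (∈-pairs⁺ s∈) (≡⇒≡ᵇ (I s) (I s) refl))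

  letter : ℕ → ℕ
  letter p = fromMaybe 0 (block ps (p ∸ 1))

  letter-in-block : ∀ {p s} → InBlock p s → letter p ≡ J s
  letter-in-block {suc p} (s∈ , prev<1+p , 1+p≤I)
    rewrite block-pairs ≤-refl (proj₁ s∈) (proj₂ s∈) (≤-pred prev<1+p) 1+p≤I = refl

  letter-range : ∀ {p} → InRange n p → 1 ≤ letter p × letter p ≤ p
  letter-range p∈ with block-of p∈
  ... | s , inB@(s∈ , prev<p , _) rewrite letter-in-block inB = J≥1 s∈ , ≤-trans (J≤1+prevI s∈) prev<p

  unmarked-below-end : ∀ {p s} → InBlock p s → ¬ Marked p → p < I s
  unmarked-below-end {s = s} (s∈ , _ , p≤I) ¬mk = ≤∧≢⇒< p≤I (λ eq → ¬mk (s , s∈ , sym eq))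

  later-block : ∀ {s p t} → InRange k s → I s < p → InBlock p t → s < t
  later-block {s} (1≤s , s≤k) Is<p ((1≤t , _) , _ , p≤It) =
    ≰⇒> λ t≤s → <⇒≱ Is<p (≤-trans p≤It (increasing-≤ I-step 1≤t t≤s s≤k))

  -- π q = (1, w₁)(2, w₂)⋯(q, w_q), the product of the first q factors of φ(w)
  π : ℕ → ℕ → ℕ
  π zero    z = z
  π (suc q) z = transp (suc q) (letter (suc q)) (π q z)

  π⁻¹ : ℕ → ℕ → ℕ
  π⁻¹ zero    z = z
  π⁻¹ (suc q) z = π⁻¹ q (transp (suc q) (letter (suc q)) z)

  π-π⁻¹ : ∀ q z → π q (π⁻¹ q z) ≡ z
  π-π⁻¹ zero    z = refl
  π-π⁻¹ (suc q) z = trans (cong (transp (suc q) (letter (suc q))) (π-π⁻¹ q _))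
                          (transp-involutive (suc q) (letter (suc q)) z)

  π⁻¹-π : ∀ q z → π⁻¹ q (π q z) ≡ z
  π⁻¹-π zero    z = refl
  π⁻¹-π (suc q) z = trans (cong (π⁻¹ q) (transp-involutive (suc q) (letter (suc q)) (π q z)))
                          (π⁻¹-π q z)

  π-injective : ∀ q → Injective _≡_ _≡_ (π q)
  π-injective q {a} {b} eq = trans (sym (π⁻¹-π q a)) (trans (cong (π⁻¹ q) eq) (π⁻¹-π q b))

  transp-letter-range : ∀ {q z} → suc q ≤ n → InRange n z → InRange n (transp (suc q) (letter (suc q)) z)
  transp-letter-range {q} 1+q≤n =
    transp-preserves (InRange n) (s≤s z≤n , 1+q≤n) (proj₁ w-range , ≤-trans (proj₂ w-range) 1+q≤n)
    where w-range = letter-range (s≤s z≤n , 1+q≤n)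

  π-range : ∀ q {z} → q ≤ n → InRange n z → InRange n (π q z)
  π-range zero    _   z∈ = z∈
  π-range (suc q) q<n z∈ = transp-letter-range q<n (π-range q (<⇒≤ q<n) z∈)

  π⁻¹-range : ∀ q {z} → q ≤ n → InRange n z → InRange n (π⁻¹ q z)
  π⁻¹-range zero    _   z∈ = z∈
  π⁻¹-range (suc q) q<n z∈ = π⁻¹-range q (<⇒≤ q<n) (transp-letter-range q<n z∈)

  π-fixes : ∀ {q z} → q ≤ n → q < z → π q z ≡ z
  π-fixes {zero}      _   _   = refl
  π-fixes {suc q} {z} q<n q<z rewrite π-fixes (<⇒≤ q<n) (<-trans (n<1+n q) q<z) =
    transp-other (λ z≡ → <-irrefl (sym z≡) q<z)
                 (λ z≡ → <-irrefl (sym z≡) (≤-<-trans (proj₂ (letter-range (s≤s z≤n , q<n))) q<z))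

  InBlock≤n : ∀ {z s} → InBlock z s → z ≤ n
  InBlock≤n (s∈ , _ , z≤I) = ≤-trans z≤I (proj₂ (I-range s∈))

  π-diagonal : ∀ {z s} → InBlock z s → π z z ≡ J s
  π-diagonal {suc z} inB
    rewrite π-fixes {z} {suc z} (<⇒≤ (InBlock≤n inB)) (n<1+n z) | transp-left (suc z) (letter (suc z))
    = letter-in-block inB

  π-shift : ∀ {z s q} → InBlock z s → z < q → q ≤ I s → π q z ≡ suc z
  π-shift {z} {s} {suc q} inB@(s∈ , prev<z , _) (s≤s z≤q) 1+q≤I with m≤n⇒m<n∨m≡n z≤q
  ... | inj₂ refl
    rewrite π-diagonal inB | letter-in-block (s∈ , <-trans prev<z (n<1+n z) , 1+q≤I)
    = transp-right (suc z) (J s)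
  ... | inj₁ z<q
    rewrite π-shift inB z<q (<⇒≤ 1+q≤I)
          | letter-in-block (s∈ , <-trans prev<z (<-trans z<q (n<1+n q)) , 1+q≤I)
    = transp-other (λ eq → <-irrefl (suc-injective eq) z<q)
                   (λ eq → <-irrefl (sym eq) (≤-<-trans (J≤1+prevI s∈) (s≤s prev<z)))

  π-marked : ∀ {s q} → InRange k s → I s ≤ q → q ≤ n → π q (I s) ≡ J s
  π-marked {s} {q} s∈ Is≤q q≤n with m≤n⇒m<n∨m≡n Is≤q
  ... | inj₂ refl = π-diagonal (s∈ , prevI<I s∈ , ≤-refl)
  ... | inj₁ Is<q@(s≤s {n = q′} Is≤q′) with block-of (s≤s z≤n , q≤n)
  ...   | t , inB@((_ , t≤k) , _)
    rewrite π-marked s∈ Is≤q′ (<⇒≤ q≤n) | letter-in-block inB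
    = transp-other (λ eq → <-irrefl eq (≤-<-trans (J≤I s∈) Is<q))
                   (λ eq → <-irrefl eq (increasing-< J-step (proj₁ s∈) (later-block s∈ Is<q inB) t≤k))

  π-climbs : ∀ {x s} → InBlock x s → ∀ i → i + x ≤ I s → fold x (π (I s)) i ≡ i + x
  π-climbs inB             zero    _      = refl
  π-climbs {x} inB@(s∈ , prev<x , _) (suc i) 1+i+x≤I rewrite π-climbs inB i (<⇒≤ 1+i+x≤I) =
    π-shift (s∈ , <-≤-trans prev<x (m≤n+m x i) , <⇒≤ 1+i+x≤I) 1+i+x≤I ≤-refl

  excursion-at-block-end : ∀ {x s} → InBlock x s → x < I s →
                           Excursion (π (I s)) x (I s) (I s ∸ x) (J s)
  excursion-at-block-end {x} {s} inB@(s∈ , _ , _) x<I = record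
    { nonempty = m<n⇒0<n∸m x<I
    ; fits     = ≤-reflexive ℓ+x≡I
    ; inside   = λ {i} i<ℓ → let 1+i+x≤I = ≤-trans (+-monoˡ-≤ x i<ℓ) (≤-reflexive ℓ+x≡I) in
                   subst (λ v → x < v × v ≤ I s) (sym (π-climbs inB (suc i) 1+i+x≤I))
                         (m<n+m x (s≤s z≤n) , 1+i+x≤I)
    ; lands    = begin
        π (I s) (fold x (π (I s)) (I s ∸ x)) ≡⟨ cong (π (I s)) (π-climbs inB _ (≤-reflexive ℓ+x≡I)) ⟩
        π (I s) (I s ∸ x + x)                ≡⟨ cong (π (I s)) ℓ+x≡I ⟩
        π (I s) (I s)                        ≡⟨ π-diagonal (s∈ , prevI<I s∈ , ≤-refl) ⟩
        J s                                  ∎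
    }
    where
    open ≡-Reasoning
    ℓ+x≡I : I s ∸ x + x ≡ I s
    ℓ+x≡I = m∸n+n≡m (<⇒≤ x<I)

  excursion-π : ∀ {x s q} → InBlock x s → x < I s → I s ≤ q → q ≤ n →
                ∃ λ ℓ → Excursion (π q) x q ℓ (J s)
  excursion-π {x} {s} inB@(s∈ , _ , _) x<I Is≤q q≤n with m≤n⇒m<n∨m≡n Is≤q
  ... | inj₂ refl = I s ∸ x , excursion-at-block-end inB x<I
  ... | inj₁ (s≤s {n = q} Is≤q′) with excursion-π inB x<I Is≤q′ (<⇒≤ q≤n)
  ...   | ℓ , E = Splice.excursion (π-injective q) (letter (suc q)) (π-fixes (<⇒≤ q≤n) (n<1+n q))
                                   (≤-trans (J≤I s∈) Is≤q′) E

  σ : ℕ → ℕ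
  σ = π n

  σ-marked : ∀ {s} → InRange k s → σ (I s) ≡ J s
  σ-marked s∈ = π-marked s∈ (proj₂ (I-range s∈)) ≤-refl

  σ-permutes : IsPermOf n σ
  σ-permutes =
    (λ x → π-range n ≤-refl) ,
    (λ x y _ _ → π-injective n) ,
    (λ y y∈ → π⁻¹ n y , π⁻¹-range n ≤-refl y∈ , π-π⁻¹ n y)

  -- the points whose image is assigned once the construction has treated n, n-1, …, c+1
  Assigned : ℕ → ℕ → Set
  Assigned c y = InRange n y × (Marked y ⊎ c < y)

  assigned-initially : IsGraphOn σ (Assigned n) ps
  assigned-initially = record { sound = sound ; complete = complete }
    where
    sound : ∀ {a b} → (a , b) ∈ ps → Assigned n a × b ≡ σ a
    sound mem with ∈-pairs⁻ mem
    ... | s , s∈ , refl , refl = (I-range s∈ , inj₁ (s , s∈ , refl)) , sym (σ-marked s∈)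
    complete : ∀ {a} → Assigned n a → (a , σ a) ∈ ps
    complete (_ , inj₁ (s , s∈ , refl)) =
      subst (λ v → (I s , v) ∈ ps) (sym (σ-marked s∈)) (∈-pairs⁺ s∈)
    complete ((_ , a≤n) , inj₂ n<a) = contradiction a≤n (<⇒≱ n<a)

  assigned-weaken : ∀ {i a} → Assigned (suc i) a → Assigned i a
  assigned-weaken (a∈ , inj₁ mk)  = a∈ , inj₁ mk
  assigned-weaken (a∈ , inj₂ 1+i<a) = a∈ , inj₂ (<-trans (n<1+n _) 1+i<a)

  assigned-split : ∀ {i a} → Assigned i a → Assigned (suc i) a ⊎ a ≡ suc i
  assigned-split         (a∈ , inj₁ mk)  = inj₁ (a∈ , inj₁ mk)
  assigned-split {i} {a} (a∈ , inj₂ i<a) with a ≟ suc i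
  ... | yes a≡1+i = inj₂ a≡1+i
  ... | no  a≢1+i = inj₁ (a∈ , inj₂ (≤∧≢⇒< i<a (a≢1+i ∘ sym)))

  assigned-marked : ∀ {i a} → Marked (suc i) → Assigned i a → Assigned (suc i) a
  assigned-marked mk a∈ with assigned-split a∈
  ... | inj₁ a∈′  = a∈′
  ... | inj₂ refl = proj₁ a∈ , inj₁ mk

  chase-finds-σ : ∀ {x s m} → InBlock x s → x < I s → ¬ Marked x → IsGraphOn σ (Assigned x) m →
                  chase (suc n) m (J s) ≡ just (σ x)
  chase-finds-σ {x} {s} {m} inB@(s∈ , _ , _) x<I ¬mk G
    with excursion-π inB x<I (proj₂ (I-range s∈)) ≤-refl
  ... | ℓ , E = subst (λ y → chase (suc n) m y ≡ just (σ x)) lands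
                  (GraphOf.chase-orbit (π-injective n) G unassigned nonempty ℓ≤1+n above)
    where
    open Excursion E
    unassigned : ¬ Assigned x x
    unassigned (_ , inj₁ mk)  = ¬mk mk
    unassigned (_ , inj₂ x<x) = <-irrefl refl x<x
    ℓ≤1+n : ℓ ≤ suc n
    ℓ≤1+n = m≤n⇒m≤1+n (≤-trans (m≤m+n ℓ x) fits)
    above : ∀ {i} → i < ℓ → Assigned x (fold x σ (suc i))
    above i<ℓ = let (x<v , v≤n) = inside i<ℓ in (≤-trans (s≤s z≤n) x<v , v≤n) , inj₂ x<v

  fill-graph : ∀ c {m} → c ≤ n → IsGraphOn σ (Assigned c) m →
               ∃ λ m′ → fill n ps c m ≡ just m′ × IsGraphOn σ (Assigned 0) m′
  fill-graph zero        _   G = _ , refl , G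
  fill-graph (suc i) {m} i<n G with isMarked ps (suc i) | marked-reflects (suc i)
  ... | true  | ofʸ mk  = fill-graph i (<⇒≤ i<n) (graph-cong assigned-weaken (assigned-marked mk) G)
  ... | false | ofⁿ ¬mk with block-of (s≤s z≤n , i<n)
  ...   | s , inB@((1≤s , s≤k) , prev<1+i , _)
    rewrite block-pairs ≤-refl 1≤s s≤k (<⇒≤ prev<1+i) (unmarked-below-end inB ¬mk)
          | chase-finds-σ inB (unmarked-below-end inB ¬mk) ¬mk G
    = fill-graph i (<⇒≤ i<n)
        (graph-extend assigned-weaken assigned-split ((s≤s z≤n , i<n) , inj₂ ≤-refl) G)

  construct-computes-σ : ∃ λ m → construct n k I J ≡ just m ×
                                 (∀ x → InRange n x → σ x ≡ toFun m x)
  construct-computes-σ with fill-graph n ≤-refl assigned-initially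
  ... | m , computes , G = m , computes , λ x x∈ →
    sym (cong (fromMaybe 0) (GraphOf.applyP-inside (π-injective n) G (x∈ , inj₂ (proj₁ x∈))))

  σ-anti-exceedances : ∀ i → InRange n i → (IsAntiExc σ i ⇔ Marked i)
  σ-anti-exceedances i i∈ = mk⇔ to from
    where
    from : Marked i → σ i ≤ i
    from (s , s∈ , refl) = subst (_≤ I s) (sym (σ-marked s∈)) (J≤I s∈)
    to : σ i ≤ i → Marked i
    to σi≤i with isMarked ps i | marked-reflects i | block-of i∈
    ... | true  | ofʸ mk  | _ = mk
    ... | false | ofⁿ ¬mk | s , inB@(s∈ , _ , _)
      with excursion-π inB (unmarked-below-end inB ¬mk) (proj₂ (I-range s∈)) ≤-refl
    ...   | _ , E = contradiction σi≤i (<⇒≱ (proj₁ (Excursion.inside E (Excursion.nonempty E))))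

  nomWord-suc : ∀ t → nomWord (suc t) I J ≡
                      nomWord t I J ++ replicate (I (suc t) ∸ prevI (suc t)) (J (suc t))
  nomWord-suc zero    = refl
  nomWord-suc (suc t) = refl

  phiFrom-replicate : ∀ a r {c} → (∀ {p} → a < p → p ≤ a + r → letter p ≡ c) →
                      ∀ z → phiFrom (suc a) (replicate r c) (π a z) ≡ π (a + r) z
  phiFrom-replicate a zero    _ z = cong (λ t → π t z) (sym (+-identityʳ a))
  phiFrom-replicate a (suc r) {c} letter≡c z = begin
    phiFrom (suc (suc a)) (replicate r c) (transp (suc a) c (π a z))
      ≡⟨ cong (λ w → phiFrom (suc (suc a)) (replicate r c) (transp (suc a) w (π a z)))
              (sym (letter≡c (n<1+n a) (subst (suc a ≤_) (sym a+1+r≡1+a+r) (s≤s (m≤m+n a r))))) ⟩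
    phiFrom (suc (suc a)) (replicate r c) (π (suc a) z)
      ≡⟨ phiFrom-replicate (suc a) r letter≡c′ z ⟩
    π (suc a + r) z
      ≡⟨ cong (λ t → π t z) a+1+r≡1+a+r ⟨
    π (a + suc r) z ∎
    where
    open ≡-Reasoning
    a+1+r≡1+a+r : a + suc r ≡ suc (a + r)
    a+1+r≡1+a+r = +-suc a r
    letter≡c′ : ∀ {p} → suc a < p → p ≤ suc a + r → letter p ≡ c
    letter≡c′ {p} 1+a<p p≤ = letter≡c (<-trans (n<1+n a) 1+a<p) (subst (p ≤_) (sym a+1+r≡1+a+r) p≤)

  nomWord-prefix : ∀ t → t ≤ k →
    length (nomWord t I J) ≡ prevI (suc t) × subexFrom 1 (nomWord t I J) ×
    (∀ z → phi (nomWord t I J) z ≡ π (prevI (suc t)) z)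
  nomWord-prefix zero    _   = refl , _ , λ z → refl
  nomWord-prefix (suc t) t<k rewrite nomWord-suc t with nomWord-prefix t (<⇒≤ t<k)
  ... | len , subex , φw≗π = length-eq , subex-++ , φ-eq
    where
    open ≡-Reasoning
    s∈ : InRange k (suc t)
    s∈ = s≤s z≤n , t<k
    a = prevI (suc t)
    d = I (suc t) ∸ a
    w = nomWord t I J
    v = replicate d (J (suc t))
    a+d≡I : a + d ≡ I (suc t)
    a+d≡I = m+[n∸m]≡n (<⇒≤ (prevI<I s∈))
    length-eq : length (w ++ v) ≡ I (suc t)
    length-eq = trans (length-++ w) (trans (cong₂ _+_ len (length-replicate d)) a+d≡I)
    subex-++ : subexFrom 1 (w ++ v)
    subex-++ = subexFrom-++ 1 w v subex
      (subst (λ ℓ → subexFrom (suc ℓ) v) (sym len) (subexFrom-replicate d (J≥1 s∈) (J≤1+prevI s∈)))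
    letter≡J : ∀ {p} → a < p → p ≤ a + d → letter p ≡ J (suc t)
    letter≡J {p} a<p p≤ = letter-in-block (s∈ , a<p , subst (p ≤_) a+d≡I p≤)
    φ-eq : ∀ z → phi (w ++ v) z ≡ π (I (suc t)) z
    φ-eq z = begin
      phiFrom 1 (w ++ v) z                      ≡⟨ phiFrom-++ 1 w v z ⟩
      phiFrom (suc (length w)) v (phi w z)      ≡⟨ cong₂ (λ ℓ y → phiFrom (suc ℓ) v y) len (φw≗π z) ⟩
      phiFrom (suc a) v (π a z)                 ≡⟨ phiFrom-replicate a d letter≡J z ⟩
      π (a + d) z                               ≡⟨ cong (λ q → π q z) a+d≡I ⟩
      π (I (suc t)) z                           ∎

  σ-nom-code : NomCodeIs n σ (nomWord k I J)
  σ-nom-code with m≤n⇒∃[o]m+o≡n 1≤k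
  ... | r , refl with nomWord-prefix (suc r) ≤-refl
  ...   | len , subex , φw≗π =
    (trans len Iₖ≡n , subex) , λ z _ → trans (φw≗π z) (cong (λ q → π q z) Iₖ≡n)

theorem4p1 : (n k : ℕ) (I J : ℕ → ℕ) →
    1 ≤ k → k ≤ n →
    1 ≤ I 1 →
    (∀ s → 1 ≤ s → s < k → I s < I (suc s)) →
    I k ≡ n →
    J 1 ≡ 1 →
    (∀ s → 1 ≤ s → s < k → J s < J (suc s)) →
    (∀ s → 2 ≤ s → s ≤ k → J s ≤ I (s ∸ 1) + 1) →
    ∃ λ m → construct n k I J ≡ just m ×
    IsPermOf n (toFun m) ×
    (∀ i → InRange n i → (IsAntiExc (toFun m) i ⇔ (∃ λ s → InRange k s × I s ≡ i))) ×
    (∀ s → InRange k s → toFun m (I s) ≡ J s) ×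
    NomCodeIs n (toFun m) (nomWord k I J)
theorem4p1 n k I J 1≤k _ 1≤I₁ I-step Iₖ≡n J₁≡1 J-step J-bound =
  let open Construction n k I J 1≤k 1≤I₁ I-step Iₖ≡n J₁≡1 J-step J-bound
      (m , computes , σ≗m) = construct-computes-σ
  in m , computes ,
     IsPermOf-agree σ≗m σ-permutes ,
     (λ i i∈ → subst (λ v → (v ≤ i) ⇔ Marked i) (σ≗m i i∈) (σ-anti-exceedances i i∈)) ,
     (λ s s∈ → trans (sym (σ≗m (I s) (I-range s∈))) (σ-marked s∈)) ,
     NomCodeIs-agree σ≗m σ-nom-code
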